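{- Let $K$ be a real quadratic number field with ring of integers $\mathcal O_K$. If there exists a $\mathbb Z$-form that is universal over $\mathcal O_K$, then $K=\mathbb Q(\sqrt 5)$.
   Context: A $\mathbb Z$-form is a positive definite quadratic form $Q(x_1,\dots,x_r)=\sum_{i\ge j}a_{ij}x_ix_j$ with all $a_{ij}\in\mathbb Z$. An element $\alpha\in K$ is totally positive if all its real embeddings are positive. A $\mathbb Z$-form $Q$ of rank $r$ is universal over $\mathcal O_K$ if for every totally positive $\alpha\in\mathcal O_K$ there is $v\in\mathcal O_K^r$ with $Q(v)=\alpha$. -}

module Defs where

open import Data.Nat as ℕ using (ℕ; zero; suc; _%_; _/_; _≡ᵇ_; _∸_; _≤ᵇ_)
open import Data.Integer as ℤ using (ℤ; +_; _+_; _*_; -_; _<_; _≤_; 0ℤ; 1ℤ)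
open import Data.Nat.Divisibility using (_∣_)
open import Data.Fin using (Fin; toℕ)
import Data.Fin as Fin
open import Data.Product using (_×_; _,_; Σ; ∃; proj₁; proj₂)
open import Data.Sum using (_⊎_)
open import Data.Bool using (Bool; true; false; if_then_else_)
open import Relation.Binary.PropositionalEquality using (_≡_; _≢_)

-- A real quadratic field K = ℚ(√d) is given by a squarefree integer d ≥ 2.
record RealQuadratic : Set where
  field
    d          : ℕ
    d≥2        : 2 ℕ.≤ d
    squarefree : ∀ (p : ℕ) → (p ℕ.* p) ∣ d → p ≡ 1
open RealQuadratic public

d≡1mod4 : ℕ → Bool
d≡1mod4 d = (d % 4) ≡ᵇ 1

-- O_K = ℤ[ω] with ω = (1+√d)/2 if d ≡ 1 (mod 4) and ω = √d otherwise.
-- The pair (a , b) represents a + b ω.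
𝒪 : RealQuadratic → Set
𝒪 K = ℤ × ℤ

ι : (K : RealQuadratic) → ℤ → 𝒪 K
ι K n = n , 0ℤ

zero𝒪 : (K : RealQuadratic) → 𝒪 K
zero𝒪 K = 0ℤ , 0ℤ

add𝒪 : (K : RealQuadratic) → 𝒪 K → 𝒪 K → 𝒪 K
add𝒪 K (a , b) (c , e) = a + c , b + e

-- multiplication: ω² = ω + (d-1)/4 if d ≡ 1 (mod 4), ω² = d otherwise
mul𝒪 : (K : RealQuadratic) → 𝒪 K → 𝒪 K → 𝒪 K
mul𝒪 K (a , b) (c , e) =
  if d≡1mod4 (d K)
  then (a * c + b * e * (+ ((d K ∸ 1) / 4)) , a * e + b * c + b * e)
  else (a * c + b * e * (+ (d K))           , a * e + b * c)

-- Sign of the real number u + v √d (u v ∈ ℤ, d ≥ 2 squarefree, so √d irrational):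
-- u + v√d > 0  iff  (u ≥ 0, v ≥ 0, not both 0) or (u > 0, v < 0, u² > d v²)
--                   or (u < 0, v > 0, d v² > u²).
PosSurd : ℕ → ℤ → ℤ → Set
PosSurd d u v =
    (0ℤ ≤ u × 0ℤ ≤ v × (0ℤ < u ⊎ 0ℤ < v))
  ⊎ (0ℤ < u × v < 0ℤ × (+ d) * (v * v) < u * u)
  ⊎ (u < 0ℤ × 0ℤ < v × u * u < (+ d) * (v * v))

-- 2α written as u + v√d
twice : (K : RealQuadratic) → 𝒪 K → ℤ × ℤ
twice K (a , b) =
  if d≡1mod4 (d K)
  then ((+ 2) * a + b , b)
  else ((+ 2) * a , (+ 2) * b)

-- α is totally positive iff both real embeddings σ₁(α) = (u + v√d)/2,
-- σ₂(α) = (u − v√d)/2 are positive.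
TotallyPositive : (K : RealQuadratic) → 𝒪 K → Set
TotallyPositive K α with twice K α
... | (u , v) = PosSurd (d K) u v × PosSurd (d K) u (- v)

sumFin : {A : Set} → (A → A → A) → A → (n : ℕ) → (Fin n → A) → A
sumFin _⊕_ e zero    f = e
sumFin _⊕_ e (suc n) f = f Fin.zero ⊕ sumFin _⊕_ e n (λ i → f (Fin.suc i))

-- A quadratic form of rank r with integer coefficients a i j (only i ≥ j used):
-- Q(x) = Σ_{i ≥ j} a i j x_i x_j, evaluated in a ring given by its operations.
evalForm : {A : Set} → (A → A → A) → (A → A → A) → A → (ℤ → A) →
           (r : ℕ) → (Fin r → Fin r → ℤ) → (Fin r → A) → A
evalForm _⊕_ _⊗_ e emb r a x =
  sumFin _⊕_ e r (λ i → sumFin _⊕_ e r (λ j →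
    if toℕ j ≤ᵇ toℕ i then (emb (a i j) ⊗ (x i ⊗ x j)) else e))

evalℤ : (r : ℕ) → (Fin r → Fin r → ℤ) → (Fin r → ℤ) → ℤ
evalℤ r a x = evalForm _+_ _*_ 0ℤ (λ n → n) r a x

eval𝒪 : (K : RealQuadratic) → (r : ℕ) → (Fin r → Fin r → ℤ) → (Fin r → 𝒪 K) → 𝒪 K
eval𝒪 K r a x = evalForm (add𝒪 K) (mul𝒪 K) (zero𝒪 K) (ι K) r a x

-- A ℤ-form of rank r: integer coefficients, positive definite
-- (Q(x) > 0 for every nonzero integer vector x; for integral forms this is
-- equivalent to positive definiteness over ℝ).
record ℤForm (r : ℕ) : Set where
  field
    coeff    : Fin r → Fin r → ℤ
    posDef   : ∀ (x : Fin r → ℤ) → (∃ λ i → x i ≢ 0ℤ) → 0ℤ < evalℤ r coeff x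
open ℤForm public

Universal : (K : RealQuadratic) → {r : ℕ} → ℤForm r → Set
Universal K {r} Q =
  ∀ (α : 𝒪 K) → TotallyPositive K α → ∃ λ (v : Fin r → 𝒪 K) → eval𝒪 K r (coeff Q) v ≡ α

{-# OPTIONS --safe #-}
-- Write v ∈ O_Kʳ as x + y ω with x, y ∈ ℤʳ, where ω² = t ω + n. Then
-- Q(v) = (Q(x) + n Q(y)) + (B(x , y) + t Q(y)) ω with B the polar form of Q.
-- Represent the totally positive α = d + √d (d ≢ 1 mod 4), resp. α = (c − 1) + ω
-- (d = 4c + 1 with c ≥ 3): the ω-coordinate 1 forces y ≠ 0 (and x ≠ 0 when t = 0),
-- and then the other coordinate Q(x) + n Q(y) exceeds that of α. Among d = 4c + 1
-- with c ≤ 2 only d = 5 is squarefree and at least 2.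

module Submission where

open import Defs
open import Data.Bool using (true; false; if_then_else_; T)
open import Data.Bool.Properties using (if-cong)
open import Data.Empty using (⊥; ⊥-elim)
open import Data.Fin using (Fin; toℕ)
import Data.Fin as Fin
open import Data.Fin.Properties using (all?; ¬∀⟶∃¬)
open import Data.Integer as ℤ using (ℤ; +_; _+_; _*_; _<_; _≤_; 0ℤ; 1ℤ; +≤+; +<+; -<+)
import Data.Integer.Properties as ℤP
open import Data.Integer.Tactic.RingSolver using (solve-∀)
open import Data.Nat as ℕ using (ℕ; zero; suc; z≤n; s≤s)
import Data.Nat.Properties as ℕP
import Data.Nat.Tactic.RingSolver as ℕSolver
open import Data.Nat.DivMod using (m≡m%n+[m/n]*n; m*n/n≡m)
open import Data.Nat.Divisibility using (_∣_; ∣-refl)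
open import Data.Product using (Σ; ∃; _×_; _,_; proj₁; proj₂; uncurry)
open import Data.Product.Properties using (×-≡,≡←≡)
open import Data.Sum using (_⊎_; inj₁; inj₂)
open import Data.Unit using (tt)
open import Function using (_∘_)
open import Relation.Nullary using (¬_; yes; no)
open import Relation.Binary.PropositionalEquality

module _ {A : Set} (_⊕_ : A → A → A) (e : A) where

  sumFin-cong : ∀ n {f g : Fin n → A} → (∀ i → f i ≡ g i) →
                sumFin _⊕_ e n f ≡ sumFin _⊕_ e n g
  sumFin-cong zero    f≗g = refl
  sumFin-cong (suc n) f≗g = cong₂ _⊕_ (f≗g Fin.zero) (sumFin-cong n (f≗g ∘ Fin.suc))

  lowerSum : (r : ℕ) → (Fin r → Fin r → A) → A
  lowerSum r t = sumFin _⊕_ e r (λ i → sumFin _⊕_ e r (λ j →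
    if toℕ j ℕ.≤ᵇ toℕ i then t i j else e))

  lowerSum-cong : ∀ r {s t : Fin r → Fin r → A} → (∀ i j → s i j ≡ t i j) →
                  lowerSum r s ≡ lowerSum r t
  lowerSum-cong r s≗t = sumFin-cong r (λ i → sumFin-cong r (λ j →
    cong (λ z → if toℕ j ℕ.≤ᵇ toℕ i then z else e) (s≗t i j)))

module _ {A B : Set} {_⊕_ : A → A → A} {e : A} {_⊞_ : B → B → B} {e′ : B}
         (h : A → B) (h-e : h e ≡ e′) (h-⊕ : ∀ a b → h (a ⊕ b) ≡ h a ⊞ h b) where

  sumFin-hom : ∀ n (f : Fin n → A) → h (sumFin _⊕_ e n f) ≡ sumFin _⊞_ e′ n (h ∘ f)
  sumFin-hom zero    f = h-e
  sumFin-hom (suc n) f = trans (h-⊕ _ _) (cong (h (f Fin.zero) ⊞_) (sumFin-hom n (f ∘ Fin.suc)))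

  lowerSum-hom : ∀ r (t : Fin r → Fin r → A) →
                 h (lowerSum _⊕_ e r t) ≡ lowerSum _⊞_ e′ r (λ i j → h (t i j))
  lowerSum-hom r t = trans (sumFin-hom r _) (sumFin-cong _⊞_ e′ r (λ i →
    trans (sumFin-hom r _) (sumFin-cong _⊞_ e′ r (λ j → h-if (toℕ j ℕ.≤ᵇ toℕ i) (t i j)))))
    where
    h-if : ∀ b a → h (if b then a else e) ≡ (if b then h a else e′)
    h-if false a = h-e
    h-if true  a = refl

Σℤ : (n : ℕ) → (Fin n → ℤ) → ℤ
Σℤ = sumFin _+_ 0ℤ

Σℤ-+ : ∀ n (f g : Fin n → ℤ) → Σℤ n (λ i → f i + g i) ≡ Σℤ n f + Σℤ n g
Σℤ-+ zero    f g = refl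
Σℤ-+ (suc n) f g = trans (cong (_+_ (f Fin.zero + g Fin.zero)) (Σℤ-+ n (f ∘ Fin.suc) (g ∘ Fin.suc)))
                         (+-interchange (f Fin.zero) (g Fin.zero) _ _)
  where
  +-interchange : ∀ a b c e → a + b + (c + e) ≡ a + c + (b + e)
  +-interchange = solve-∀

module _ (r : ℕ) where

  lowerSumℤ : (Fin r → Fin r → ℤ) → ℤ
  lowerSumℤ = lowerSum _+_ 0ℤ r

  lowerSumℤ-+ : ∀ (s t : Fin r → Fin r → ℤ) →
                lowerSumℤ (λ i j → s i j + t i j) ≡ lowerSumℤ s + lowerSumℤ t
  lowerSumℤ-+ s t = trans (sumFin-cong _+_ 0ℤ r (λ i →
      trans (sumFin-cong _+_ 0ℤ r (λ j → if-+ (toℕ j ℕ.≤ᵇ toℕ i) (s i j) (t i j))) (Σℤ-+ r _ _)))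
    (Σℤ-+ r _ _)
    where
    if-+ : ∀ b u v → (if b then u + v else 0ℤ) ≡ (if b then u else 0ℤ) + (if b then v else 0ℤ)
    if-+ false u v = refl
    if-+ true  u v = refl

  lowerSumℤ-*ˡ : ∀ c (t : Fin r → Fin r → ℤ) → lowerSumℤ (λ i j → c * t i j) ≡ c * lowerSumℤ t
  lowerSumℤ-*ˡ c t = sym (lowerSum-hom (c *_) (ℤP.*-zeroʳ c) (ℤP.*-distribˡ-+ c) r t)

  lowerSumℤ-+-* : ∀ c (s t : Fin r → Fin r → ℤ) →
                  lowerSumℤ (λ i j → s i j + c * t i j) ≡ lowerSumℤ s + c * lowerSumℤ t
  lowerSumℤ-+-* c s t = trans (lowerSumℤ-+ s _) (cong (_+_ (lowerSumℤ s)) (lowerSumℤ-*ˡ c t))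

  lowerSumℤ-zero : ∀ (t : Fin r → Fin r → ℤ) → (∀ i j → t i j ≡ 0ℤ) → lowerSumℤ t ≡ 0ℤ
  -- 0ℤ * t i j reduces to 0ℤ
  lowerSumℤ-zero t t≡0 = trans (lowerSum-cong _+_ 0ℤ r t≡0) (lowerSumℤ-*ˡ 0ℤ t)

polarℤ : (r : ℕ) → (Fin r → Fin r → ℤ) → (Fin r → ℤ) → (Fin r → ℤ) → ℤ
polarℤ r a x y = lowerSumℤ r (λ i j → a i j * (x i * y j + y i * x j))

module _ {r : ℕ} (a : Fin r → Fin r → ℤ) where

  polarℤ-comm : ∀ x y → polarℤ r a x y ≡ polarℤ r a y x
  polarℤ-comm x y = lowerSum-cong _+_ 0ℤ r (λ i j → cong (a i j *_) (ℤP.+-comm (x i * y j) (y i * x j)))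

  polarℤ-zeroʳ : ∀ x {y} → (∀ i → y i ≡ 0ℤ) → polarℤ r a x y ≡ 0ℤ
  polarℤ-zeroʳ x {y} y≡0 = lowerSumℤ-zero r _ (λ i j → begin
    a i j * (x i * y j + y i * x j) ≡⟨ cong₂ (λ u v → a i j * (x i * u + v * x j)) (y≡0 j) (y≡0 i) ⟩
    a i j * (x i * 0ℤ + 0ℤ * x j)   ≡⟨ vanish (a i j) (x i) (x j) ⟩
    0ℤ                              ∎)
    where
    open ≡-Reasoning
    vanish : ∀ c u v → c * (u * 0ℤ + 0ℤ * v) ≡ 0ℤ
    vanish = solve-∀

  evalℤ-zero : ∀ {x} → (∀ i → x i ≡ 0ℤ) → evalℤ r a x ≡ 0ℤ
  evalℤ-zero {x} x≡0 = lowerSumℤ-zero r _ (λ i j →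
    trans (cong₂ (λ u v → a i j * (u * v)) (x≡0 i) (x≡0 j)) (ℤP.*-zeroʳ (a i j)))

i+n≤i+n*j : ∀ i n {j} → 0ℤ < j → i + + n ≤ i + + n * j
i+n≤i+n*j i n {j} j>0 = ℤP.+-monoʳ-≤ i (begin
  + n         ≡⟨ sym (ℤP.*-identityʳ (+ n)) ⟩
  + n * 1ℤ    ≤⟨ ℤP.*-monoˡ-≤-nonNeg (+ n) (ℤP.i<j⇒suc[i]≤j j>0) ⟩
  + n * j     ∎)
  where open ℤP.≤-Reasoning

module _ {r : ℕ} (Q : ℤForm r) where

  private
    Qℤ : (Fin r → ℤ) → ℤ
    Qℤ = evalℤ r (coeff Q)

    Bℤ : (Fin r → ℤ) → (Fin r → ℤ) → ℤ
    Bℤ = polarℤ r (coeff Q)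

  zero⊎evalℤ>0 : ∀ x → (∀ i → x i ≡ 0ℤ) ⊎ 0ℤ < Qℤ x
  zero⊎evalℤ>0 x with all? (λ i → x i ℤ.≟ 0ℤ)
  ... | yes x≡0 = inj₁ x≡0
  ... | no  x≢0 = inj₂ (posDef Q x (¬∀⟶∃¬ r _ (λ i → x i ℤ.≟ 0ℤ) x≢0))

  evalℤ-nonneg : ∀ x → 0ℤ ≤ Qℤ x
  evalℤ-nonneg x with zero⊎evalℤ>0 x
  ... | inj₁ x≡0  = ℤP.≤-reflexive (sym (evalℤ-zero (coeff Q) x≡0))
  ... | inj₂ Qx>0 = ℤP.<⇒≤ Qx>0

  polar+t*evalℤ≡1⇒evalℤ>0 : ∀ t x y → Bℤ x y + t * Qℤ y ≡ 1ℤ → 0ℤ < Qℤ y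
  polar+t*evalℤ≡1⇒evalℤ>0 t x y eq with zero⊎evalℤ>0 y
  ... | inj₂ Qy>0 = Qy>0
  ... | inj₁ y≡0 with () ← trans (sym eq) (trans
    (cong₂ (λ u v → u + t * v) (polarℤ-zeroʳ (coeff Q) x y≡0) (evalℤ-zero (coeff Q) y≡0))
    (trans (ℤP.+-identityˡ (t * 0ℤ)) (ℤP.*-zeroʳ t)))

  -- the two coordinates of Q(x + y √k) ≡ k + √k
  ¬represents-k+√k : ∀ k x y → Qℤ x + + k * Qℤ y ≡ + k → Bℤ x y + 0ℤ * Qℤ y ≡ 1ℤ → ⊥
  ¬represents-k+√k k x y eq₁ eq₂ = ℤP.<-irrefl refl (begin-strict
    + k                 <⟨ ℤP.+-monoˡ-< (+ k) Qx>0 ⟩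
    Qℤ x + + k          ≤⟨ i+n≤i+n*j (Qℤ x) k Qy>0 ⟩
    Qℤ x + + k * Qℤ y   ≡⟨ eq₁ ⟩
    + k                 ∎)
    where
    open ℤP.≤-Reasoning
    Qy>0 : 0ℤ < Qℤ y
    Qy>0 = polar+t*evalℤ≡1⇒evalℤ>0 0ℤ x y eq₂
    Qx>0 : 0ℤ < Qℤ x
    Qx>0 = polar+t*evalℤ≡1⇒evalℤ>0 0ℤ y x
      (trans (cong₂ _+_ (polarℤ-comm (coeff Q) y x) (ℤP.+-identityʳ _)) eq₂)

  -- the two coordinates of Q(x + y ω) ≡ m + ω for ω² = ω + (m + 1)
  ¬represents-m+ω : ∀ m x y → Qℤ x + + suc m * Qℤ y ≡ + m → Bℤ x y + 1ℤ * Qℤ y ≡ 1ℤ → ⊥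
  ¬represents-m+ω m x y eq₁ eq₂ = ℤP.<-irrefl refl (begin-strict
    + m                     <⟨ +<+ (ℕP.n<1+n m) ⟩
    + suc m                 ≤⟨ ℤP.+-monoˡ-≤ (+ suc m) (evalℤ-nonneg x) ⟩
    Qℤ x + + suc m          ≤⟨ i+n≤i+n*j (Qℤ x) (suc m) (polar+t*evalℤ≡1⇒evalℤ>0 1ℤ x y eq₂) ⟩
    Qℤ x + + suc m * Qℤ y   ≡⟨ eq₁ ⟩
    + m                     ∎)
    where open ℤP.≤-Reasoning

-- ω² = t ω + n in the basis (1 , ω) of O_K
MulLaw : RealQuadratic → ℤ → ℤ → Set
MulLaw K t n = ∀ a b c e →
  mul𝒪 K (a , b) (c , e) ≡ (a * c + b * e * n , a * e + b * c + b * e * t)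

mulLaw-1mod4 : ∀ K {c} → d≡1mod4 (d K) ≡ true → d K ≡ 1 ℕ.+ c ℕ.* 4 → MulLaw K 1ℤ (+ c)
mulLaw-1mod4 K {c} h d≡ a b c′ e = trans (if-cong h) (cong₂ _,_
  (cong (λ k → a * c′ + b * e * + k) (trans (cong (λ m → (m ℕ.∸ 1) ℕ./ 4) d≡) (m*n/n≡m c 4)))
  (cong (_+_ (a * e + b * c′)) (sym (ℤP.*-identityʳ (b * e)))))

mulLaw-not1mod4 : ∀ K → d≡1mod4 (d K) ≡ false → MulLaw K 0ℤ (+ d K)
mulLaw-not1mod4 K h a b c e = trans (if-cong h) (cong (_,_ (a * c + b * e * + d K))
  (sym (trans (cong (_+_ (a * e + b * c)) (ℤP.*-zeroʳ (b * e))) (ℤP.+-identityʳ (a * e + b * c)))))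

lowerSum-pair : ∀ K r (t : Fin r → Fin r → 𝒪 K) → lowerSum (add𝒪 K) (zero𝒪 K) r t ≡
  (lowerSumℤ r (λ i j → proj₁ (t i j)) , lowerSumℤ r (λ i j → proj₂ (t i j)))
lowerSum-pair K r t = cong₂ _,_ (lowerSum-hom proj₁ refl (λ _ _ → refl) r t)
                                (lowerSum-hom proj₂ refl (λ _ _ → refl) r t)

module _ (K : RealQuadratic) (t n : ℤ) (law : MulLaw K t n) where

  ι-mul-mul : ∀ c xi yi xj yj → mul𝒪 K (ι K c) (mul𝒪 K (xi , yi) (xj , yj)) ≡
    (c * (xi * xj) + n * (c * (yi * yj)) , c * (xi * yj + yi * xj) + t * (c * (yi * yj)))
  ι-mul-mul c xi yi xj yj = begin
    mul𝒪 K (c , 0ℤ) (mul𝒪 K (xi , yi) (xj , yj))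
      ≡⟨ cong (mul𝒪 K (c , 0ℤ)) (law xi yi xj yj) ⟩
    mul𝒪 K (c , 0ℤ) (u , w)
      ≡⟨ law c 0ℤ u w ⟩
    (c * u + 0ℤ * w * n , c * w + 0ℤ * u + 0ℤ * w * t)
      ≡⟨ cong₂ _,_ (first c xi yi xj yj n) (second c xi yi xj yj n t) ⟩
    (c * (xi * xj) + n * (c * (yi * yj)) , c * (xi * yj + yi * xj) + t * (c * (yi * yj))) ∎
    where
    open ≡-Reasoning
    u w : ℤ
    u = xi * xj + yi * yj * n
    w = xi * yj + yi * xj + yi * yj * t
    first : ∀ c xi yi xj yj n → c * (xi * xj + yi * yj * n) + 0ℤ * n ≡ c * (xi * xj) + n * (c * (yi * yj))
    first = solve-∀
    second : ∀ c xi yi xj yj n t → c * (xi * yj + yi * xj + yi * yj * t) + 0ℤ + 0ℤ * t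
                                 ≡ c * (xi * yj + yi * xj) + t * (c * (yi * yj))
    second = solve-∀

  eval𝒪-decompose : ∀ {r} (a : Fin r → Fin r → ℤ) (v : Fin r → 𝒪 K) →
    let x = proj₁ ∘ v ; y = proj₂ ∘ v in
    eval𝒪 K r a v ≡ (evalℤ r a x + n * evalℤ r a y , polarℤ r a x y + t * evalℤ r a y)
  eval𝒪-decompose {r} a v = begin
    eval𝒪 K r a v
      ≡⟨ lowerSum-cong (add𝒪 K) (zero𝒪 K) r (λ i j → ι-mul-mul (a i j) (x i) (y i) (x j) (y j)) ⟩
    lowerSum (add𝒪 K) (zero𝒪 K) r (λ i j → (Qx i j + n * Qy i j , Bxy i j + t * Qy i j))
      ≡⟨ lowerSum-pair K r _ ⟩
    (lowerSumℤ r (λ i j → Qx i j + n * Qy i j) , lowerSumℤ r (λ i j → Bxy i j + t * Qy i j))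
      ≡⟨ cong₂ _,_ (lowerSumℤ-+-* r n Qx Qy) (lowerSumℤ-+-* r t Bxy Qy) ⟩
    (evalℤ r a x + n * evalℤ r a y , polarℤ r a x y + t * evalℤ r a y) ∎
    where
    open ≡-Reasoning
    x y : Fin r → ℤ
    x = proj₁ ∘ v
    y = proj₂ ∘ v
    Qx Qy Bxy : Fin r → Fin r → ℤ
    Qx  i j = a i j * (x i * x j)
    Qy  i j = a i j * (y i * y j)
    Bxy i j = a i j * (x i * y j + y i * x j)

  eval𝒪-coordinates : ∀ {r} (a : Fin r → Fin r → ℤ) (v : Fin r → 𝒪 K) {b₀ b₁} →
    let x = proj₁ ∘ v ; y = proj₂ ∘ v in
    eval𝒪 K r a v ≡ (b₀ , b₁) →
    evalℤ r a x + n * evalℤ r a y ≡ b₀ × polarℤ r a x y + t * evalℤ r a y ≡ b₁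
  eval𝒪-coordinates a v Qv≡b = ×-≡,≡←≡ (trans (sym (eval𝒪-decompose a v)) Qv≡b)

module _ (K : RealQuadratic) where

  totallyPositive-m+√d : ∀ m → d≡1mod4 (d K) ≡ false → d K ℕ.< m ℕ.* m →
                         TotallyPositive K (+ m , 1ℤ)
  totallyPositive-m+√d zero      h ()
  totallyPositive-m+√d m@(suc _) h d<m² rewrite h =
      inj₁ (ℤP.<⇒≤ 0<2m , +≤+ z≤n , inj₂ (+<+ (s≤s z≤n)))
    , inj₂ (inj₁ (0<2m , -<+ , subst₂ _<_ (ℤP.pos-* (d K) 4) [2m]² (+<+ 4d<[2m]²)))
    where
    2m≡ : + (2 ℕ.* m) ≡ + 2 * + m
    2m≡ = ℤP.pos-* 2 m
    0<2m : 0ℤ < + 2 * + m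
    0<2m = subst (0ℤ <_) 2m≡ (+<+ (s≤s z≤n))
    [2m]² : + (2 ℕ.* m ℕ.* (2 ℕ.* m)) ≡ + 2 * + m * (+ 2 * + m)
    [2m]² = trans (ℤP.pos-* (2 ℕ.* m) (2 ℕ.* m)) (cong₂ _*_ 2m≡ 2m≡)
    square : ∀ m → m ℕ.* m ℕ.* 4 ≡ 2 ℕ.* m ℕ.* (2 ℕ.* m)
    square = ℕSolver.solve-∀
    4d<[2m]² : d K ℕ.* 4 ℕ.< 2 ℕ.* m ℕ.* (2 ℕ.* m)
    4d<[2m]² = subst (d K ℕ.* 4 ℕ.<_) (square m) (ℕP.*-monoˡ-< 4 d<m²)

  totallyPositive-m+ω : ∀ m → d≡1mod4 (d K) ≡ true →
                        d K ℕ.< (2 ℕ.* m ℕ.+ 1) ℕ.* (2 ℕ.* m ℕ.+ 1) → TotallyPositive K (+ m , 1ℤ)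
  totallyPositive-m+ω m h d<[2m+1]² rewrite h =
      inj₁ (ℤP.<⇒≤ 0<2m+1 , +≤+ z≤n , inj₂ (+<+ (s≤s z≤n)))
    , inj₂ (inj₁ (0<2m+1 , -<+ , subst₂ _<_ (sym (ℤP.*-identityʳ (+ d K))) [2m+1]² (+<+ d<[2m+1]²)))
    where
    2m+1≡ : + (2 ℕ.* m ℕ.+ 1) ≡ + 2 * + m + 1ℤ
    2m+1≡ = trans (ℤP.pos-+ (2 ℕ.* m) 1) (cong (_+ 1ℤ) (ℤP.pos-* 2 m))
    0<2m+1 : 0ℤ < + 2 * + m + 1ℤ
    0<2m+1 = subst (0ℤ <_) 2m+1≡ (+<+ (ℕP.m≤n+m 1 (2 ℕ.* m)))
    [2m+1]² : + ((2 ℕ.* m ℕ.+ 1) ℕ.* (2 ℕ.* m ℕ.+ 1)) ≡ (+ 2 * + m + 1ℤ) * (+ 2 * + m + 1ℤ)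
    [2m+1]² = trans (ℤP.pos-* (2 ℕ.* m ℕ.+ 1) (2 ℕ.* m ℕ.+ 1)) (cong₂ _*_ 2m+1≡ 2m+1≡)

n<n*n : ∀ {n} → 2 ℕ.≤ n → n ℕ.< n ℕ.* n
n<n*n {n@(suc _)} 2≤n = ℕP.m<m*n n n 2≤n

5+4m<[2m+1]² : ∀ {m} → 2 ℕ.≤ m → 1 ℕ.+ suc m ℕ.* 4 ℕ.< (2 ℕ.* m ℕ.+ 1) ℕ.* (2 ℕ.* m ℕ.+ 1)
5+4m<[2m+1]² {m@(suc (suc e))} (s≤s (s≤s _)) =
  subst (1 ℕ.+ suc m ℕ.* 4 ℕ.<_) (sym (gap e)) (ℕP.m<m+n (1 ℕ.+ suc m ℕ.* 4) (s≤s z≤n))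
  where
  gap : ∀ e → (2 ℕ.* (2 ℕ.+ e) ℕ.+ 1) ℕ.* (2 ℕ.* (2 ℕ.+ e) ℕ.+ 1)
            ≡ (1 ℕ.+ (3 ℕ.+ e) ℕ.* 4) ℕ.+ (12 ℕ.+ 16 ℕ.* e ℕ.+ 4 ℕ.* e ℕ.* e)
  gap = ℕSolver.solve-∀

module _ (K : RealQuadratic) {r : ℕ} (Q : ℤForm r) where

  ¬universal-not1mod4 : d≡1mod4 (d K) ≡ false → ¬ Universal K Q
  ¬universal-not1mod4 h U with U (+ d K , 1ℤ) (totallyPositive-m+√d K (d K) h (n<n*n (d≥2 K)))
  ... | v , Qv≡α = uncurry (¬represents-k+√k Q (d K) (proj₁ ∘ v) (proj₂ ∘ v))
    (eval𝒪-coordinates K 0ℤ (+ d K) (mulLaw-not1mod4 K h) (coeff Q) v Qv≡α)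

  ¬universal-1mod4 : ∀ c → d≡1mod4 (d K) ≡ true → d K ≡ 1 ℕ.+ c ℕ.* 4 → 3 ℕ.≤ c → ¬ Universal K Q
  ¬universal-1mod4 c@(suc m) h d≡ (s≤s 2≤m) U
    with U (+ m , 1ℤ) (totallyPositive-m+ω K m h (subst (ℕ._< _) (sym d≡) (5+4m<[2m+1]² 2≤m)))
  ... | v , Qv≡α = uncurry (¬represents-m+ω Q m (proj₁ ∘ v) (proj₂ ∘ v))
    (eval𝒪-coordinates K 1ℤ (+ c) (mulLaw-1mod4 K h d≡) (coeff Q) v Qv≡α)

≡1+[n/4]*4 : ∀ n → d≡1mod4 n ≡ true → n ≡ 1 ℕ.+ n ℕ./ 4 ℕ.* 4
≡1+[n/4]*4 n h = trans (m≡m%n+[m/n]*n n 4)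
  (cong (ℕ._+ n ℕ./ 4 ℕ.* 4) (ℕP.≡ᵇ⇒≡ (n ℕ.% 4) 1 (subst T (sym h) tt)))

theorem1 : (K : RealQuadratic) →
    (∃ λ (r : ℕ) → Σ (ℤForm r) λ Q → Universal K Q) →
    d K ≡ 5
theorem1 K (r , Q , U) = by-residue (d≡1mod4 (d K)) refl
  where
  d≡5 : d≡1mod4 (d K) ≡ true → ∀ c → d K ≡ 1 ℕ.+ c ℕ.* 4 → d K ≡ 5
  d≡5 h 0 d≡1 with s≤s () ← subst (2 ℕ.≤_) d≡1 (d≥2 K)
  d≡5 h 1 d≡5 = d≡5
  d≡5 h 2 d≡9 with () ← squarefree K 3 (subst (3 ℕ.* 3 ∣_) (sym d≡9) ∣-refl)
  d≡5 h c@(suc (suc (suc _))) d≡ = ⊥-elim (¬universal-1mod4 K Q c h d≡ (s≤s (s≤s (s≤s z≤n))) U)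

  by-residue : ∀ b → d≡1mod4 (d K) ≡ b → d K ≡ 5
  by-residue false h = ⊥-elim (¬universal-not1mod4 K Q h U)
  by-residue true  h = d≡5 h (d K ℕ./ 4) (≡1+[n/4]*4 (d K) h)
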